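{- The parametric zone graph of an extended 1-clock PTA is finite.
   Context: An extended 1-clock PTA (1cPTA) is a parametric timed automaton $(\Sigma,L,\ell_0,\{x\},P,I,E)$ with a single real-valued clock $x$, finitely many parameters $P$ (nonnegative rationals), and whose guards and invariants are conjunctions of constraints $x\sim\sum_i\alpha_ip_i+c$ with $p_i\in P$, $\alpha_i,c\in\mathbb Z$, $\sim\in\{<,\le,=,\ge,>\}$; edges are $(\ell,g,a,R,\ell')$ with guard $g$, action $a$, reset set $R\subseteq\{x\}$. Symbolic states are pairs $(\ell,C)$ with $C$ a constraint over $\{x\}\cup P$. $C\!\uparrow$ (time elapsing) is satisfied by $(w+d,v)$ whenever $(w,v)\models C$, $d\ge0$; $C[R]$ sets the clocks in $R$ to $0$ (existentially eliminating their old values). The initial symbolic state is $(\ell_0,(x=0)\!\uparrow\wedge I(\ell_0))$; for an edge $e=(\ell,g,a,R,\ell')$, the successor of $(\ell,C)$ is $(\ell',((C\wedge g)[R])\!\uparrow\wedge I(\ell'))$ if this constraint is satisfiable (none otherwise). The parametric zone graph is the transition system of symbolic states reachable from the initial one via successors (constraints identified up to equivalence).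
   Formalization: The clock x and the time delays $d$ take rational values instead of real ones. -}

module Defs where

open import Data.Nat using (ℕ; zero; suc)
open import Data.Integer using (ℤ)
open import Data.Rational using (ℚ; 0ℚ; _+_; _*_; _-_; _/_; _≤_; _<_; _≥_; _>_)
open import Data.Fin using (Fin)
open import Data.Bool using (Bool; true; false)
open import Data.List using (List; []; _∷_)
open import Data.List.Relation.Unary.All using (All)
open import Data.List.Relation.Unary.Any using (Any)
open import Data.Product using (Σ; _×_; _,_)
open import Relation.Binary.PropositionalEquality using (_≡_)

ℤ→ℚ : ℤ → ℚ
ℤ→ℚ z = z / 1

sumFin : (n : ℕ) → (Fin n → ℚ) → ℚ
sumFin zero    f = 0ℚ
sumFin (suc n) f = f Fin.zero + sumFin n (λ i → f (Fin.suc i))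

data Rel : Set where
  lt le eq ge gt : Rel

-- atomic constraint  x ~ Σ αᵢ pᵢ + c  over np parameters
record Atom (np : ℕ) : Set where
  constructor atom
  field
    rel   : Rel
    coeff : Fin np → ℤ
    const : ℤ

Guard : ℕ → Set
Guard np = List (Atom np)

Val : ℕ → Set
Val np = Fin np → ℚ

-- semantic constraint over {x} ∪ P : set of pairs (clock value, parameter valuation)
Constr : ℕ → Set₁
Constr np = ℚ → Val np → Set

relSem : Rel → ℚ → ℚ → Set
relSem lt a b = a < b
relSem le a b = a ≤ b
relSem eq a b = a ≡ b
relSem ge a b = a ≥ b
relSem gt a b = a > b

atomSem : {np : ℕ} → Atom np → Constr np
atomSem {np} (atom r α c) w v =
  relSem r w (sumFin np (λ i → ℤ→ℚ (α i) * v i) + ℤ→ℚ c)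

guardSem : {np : ℕ} → Guard np → Constr np
guardSem g w v = All (λ a → atomSem a w v) g

-- edge (ℓ, g, a, R, ℓ') ; R ⊆ {x} encoded as a Bool (true = reset x)
record Edge (nL nΣ np : ℕ) : Set where
  constructor edge
  field
    src    : Fin nL
    guard  : Guard np
    action : Fin nΣ
    reset  : Bool
    tgt    : Fin nL

-- extended 1-clock PTA with finite locations Fin nL, alphabet Fin nΣ,
-- parameters Fin np, one clock x
record PTA : Set where
  field
    nL nΣ np : ℕ
    ℓ₀    : Fin nL
    inv   : Fin nL → Guard np
    edges : List (Edge nL nΣ np)

_∧_ : {np : ℕ} → Constr np → Constr np → Constr np
(C ∧ D) w v = C w v × D w v

_↑ : {np : ℕ} → Constr np → Constr np
(C ↑) w v = Σ ℚ (λ d → (0ℚ ≤ d) × C (w - d) v)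

resetC : {np : ℕ} → Bool → Constr np → Constr np
resetC false C w v = C w v
resetC true  C w v = (w ≡ 0ℚ) × Σ ℚ (λ w′ → C w′ v)

Satisfiable : {np : ℕ} → Constr np → Set
Satisfiable {np} C = Σ ℚ (λ w → Σ (Val np) (λ v → C w v))

_≈_ : {np : ℕ} → Constr np → Constr np → Set
_≈_ {np} C D = (w : ℚ) (v : Val np) → (C w v → D w v) × (D w v → C w v)

module _ (A : PTA) where
  open PTA A

  NonNegVal : Constr np
  NonNegVal w v = (i : Fin np) → 0ℚ ≤ v i

  xIsZero : Constr np
  xIsZero w v = w ≡ 0ℚ

  initC : Constr np
  initC = (NonNegVal ∧ (xIsZero ↑)) ∧ guardSem (inv ℓ₀)

  -- successor constraint along edge e (defined when satisfiable)
  postC : Edge nL nΣ np → Constr np → Constr np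
  postC e C = (resetC (Edge.reset e) (C ∧ guardSem (Edge.guard e)) ↑)
              ∧ guardSem (inv (Edge.tgt e))

  data Reachable : Fin nL → Constr np → Set₁ where
    init : Reachable ℓ₀ initC
    step : {ℓ : Fin nL} {C : Constr np} (e : Edge nL nΣ np) →
           Reachable ℓ C → Any (λ e′ → e′ ≡ e) edges → Edge.src e ≡ ℓ →
           Satisfiable (postC e C) → Reachable (Edge.tgt e) (postC e C)

  FiniteZoneGraph : Set₁
  FiniteZoneGraph =
    Σ (List (Σ (Fin nL) (λ _ → Constr np))) (λ Ss →
      (ℓ : Fin nL) (C : Constr np) → Reachable ℓ C →
      Any (λ S → Σ (ℓ ≡ Data.Product.proj₁ S) (λ _ → C ≈ Data.Product.proj₂ S)) Ss)

-- Every reachable constraint is equivalent to the conjunction, over nonnegative parameter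
-- valuations, of comparisons t ≺ x, x ≺ t and t ≺ t′ (≺ ∈ {<, ≤}) between the clock x and
-- terms from a fixed finite set: 0 and the linear parameter expressions of the guards and
-- invariants. Such conjunctions are closed under adding a guard, under time elapsing (drop
-- the upper bounds on x) and under reset (replace the bounds on x by x = 0), because
-- eliminating the single variable x over the dense order ℚ (Fourier–Motzkin) only produces
-- the comparisons t ≺ t′ obtained by chaining a lower with an upper bound on x. A finite set
-- of terms admits finitely many comparisons, hence finitely many conjunctions up to equivalence.

module Submission where

open import Defs
open import Data.Nat using (ℕ; suc)
open import Data.Bool using (Bool; true; false; _∨_)
import Data.Bool.Properties as Bool
open import Data.Fin using (Fin; zero; suc)
import Data.Fin.Properties as Fin
open import Data.List
  using (List; []; _∷_; [_]; _++_; map; filter; concatMap; cartesianProduct; cartesianProductWith; allFin; length; lookup)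
import Data.List.Extrema
open import Data.List.Relation.Unary.All as All using (All; []; _∷_)
open import Data.List.Relation.Unary.All.Properties using (++⁺; ++⁻; map⁺; map⁻; cartesianProductWith⁺)
open import Data.List.Relation.Unary.Any as Any using (Any; here; there)
open import Data.List.Relation.Unary.Any.Properties using (lookup-index)
open import Data.List.Membership.Propositional using (_∈_; lose)
open import Data.List.Membership.Propositional.Properties
  using (∈-map⁺; ∈-map⁻; ∈-++⁺ˡ; ∈-++⁺ʳ; ∈-concatMap⁺; ∈-filter⁺; ∈-filter⁻;
         ∈-cartesianProductWith⁺; ∈-cartesianProduct⁺; ∈-allFin)
open import Data.List.Relation.Binary.Subset.Propositional using (_⊆_)
open import Data.List.Relation.Binary.Subset.Propositional.Properties using (All-resp-⊇)
open import Data.Product using (Σ; ∃-syntax; _×_; _,_; proj₁; proj₂; map₂)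
open import Data.Product.Properties using (≡-dec)
open import Data.Sum using ([_,_]′)
open import Data.Rational using (ℚ; 0ℚ; 1ℚ; _<_; _≤_; _+_; _-_; -_; _*_)
import Data.Rational.Properties as ℚ
open import Relation.Binary using (Setoid; DecidableEquality; DecTotalOrder)
open import Relation.Binary.PropositionalEquality
  using (_≡_; refl; sym; trans; cong; subst; setoid; module ≡-Reasoning)
open import Relation.Nullary using (yes; no; does)
open import Relation.Unary using (Pred; Decidable)
open import Function using (_∘′_)
open import Level using (0ℓ)

private
  variable
    A : Set

_≺[_]_ : ℚ → Bool → ℚ → Set
p ≺[ true  ] q = p < q
p ≺[ false ] q = p ≤ q

≺-trans : ∀ {p q r} s t → p ≺[ s ] q → q ≺[ t ] r → p ≺[ s ∨ t ] r
≺-trans true  true  = ℚ.<-trans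
≺-trans true  false = ℚ.<-≤-trans
≺-trans false true  = ℚ.≤-<-trans
≺-trans false false = ℚ.≤-trans

≺⇒≤ : ∀ {p q} s → p ≺[ s ] q → p ≤ q
≺⇒≤ true  = ℚ.<⇒≤
≺⇒≤ false p≤q = p≤q

<⇒≺ : ∀ {p q} s → p < q → p ≺[ s ] q
<⇒≺ true  p<q = p<q
<⇒≺ false = ℚ.<⇒≤

≺-weakenˡ : ∀ {p q} s t → p ≺[ s ∨ t ] q → p ≺[ s ] q
≺-weakenˡ true  t p<q = p<q
≺-weakenˡ false t = ≺⇒≤ t

≺-weakenʳ : ∀ {p q} s t → p ≺[ s ∨ t ] q → p ≺[ t ] q
≺-weakenʳ true  true  p<q = p<q
≺-weakenʳ true  false = ℚ.<⇒≤
≺-weakenʳ false t p≺q = p≺q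

≤-≺-trans : ∀ {p q r} s → p ≤ q → q ≺[ s ] r → p ≺[ s ] r
≤-≺-trans true  = ℚ.≤-<-trans
≤-≺-trans false = ℚ.≤-trans

≺-≤-trans : ∀ {p q r} s → p ≺[ s ] q → q ≤ r → p ≺[ s ] r
≺-≤-trans true  = ℚ.<-≤-trans
≺-≤-trans false = ℚ.≤-trans

p<p+1 : ∀ p → p < p + 1ℚ
p<p+1 p = subst (_< p + 1ℚ) (ℚ.+-identityʳ p) (ℚ.+-monoʳ-< p (ℚ.positive⁻¹ 1ℚ))

p-1<p : ∀ p → p - 1ℚ < p
p-1<p p = subst (p - 1ℚ <_) (ℚ.+-identityʳ p) (ℚ.+-monoʳ-< p (ℚ.neg-antimono-< (ℚ.positive⁻¹ 1ℚ)))

-- Fourier–Motzkin elimination of one rational variable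

Above : List (Bool × ℚ) → ℚ → Set
Above lowers y = All (λ (s , l) → l ≺[ s ] y) lowers

Below : ℚ → List (Bool × ℚ) → Set
Below y uppers = All (λ (t , u) → y ≺[ t ] u) uppers

Compatible : List (Bool × ℚ) → List (Bool × ℚ) → Set
Compatible lowers uppers =
  ∀ {s l t u} → (s , l) ∈ lowers → (t , u) ∈ uppers → l ≺[ s ∨ t ] u

above-below⇒compatible : ∀ {lowers uppers y} → Above lowers y → Below y uppers → Compatible lowers uppers
above-below⇒compatible above below {s} {t = t} l∈ u∈ = ≺-trans s t (All.lookup above l∈) (All.lookup below u∈)

compatible-∷ : ∀ {lowers uppers w} →
               Above lowers w → Compatible lowers uppers → Compatible lowers ((false , w) ∷ uppers)
compatible-∷ {w = w} above compat {s} {l} l∈ (here refl) =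
  subst (l ≺[_] w) (sym (Bool.∨-identityʳ s)) (All.lookup above l∈)
compatible-∷ above compat l∈ (there u∈) = compat l∈ u∈

private module ≤-Extrema = Data.List.Extrema (DecTotalOrder.totalOrder ℚ.≤-decTotalOrder)

greatest : (f : A → ℚ) (x : A) (xs : List A) →
           ∃[ m ] m ∈ x ∷ xs × All (λ y → f y ≤ f m) (x ∷ xs)
greatest f x xs =
  argmax f x xs , [ here , there ]′ (argmax-sel f x xs) ,
  f[⊥]≤f[argmax] {f = f} x xs ∷ f[xs]≤f[argmax] {f = f} x xs
  where open ≤-Extrema

least : (f : A → ℚ) (x : A) (xs : List A) →
        ∃[ m ] m ∈ x ∷ xs × All (λ y → f m ≤ f y) (x ∷ xs)
least f x xs =
  argmin f x xs , [ here , there ]′ (argmin-sel f x xs) ,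
  f[argmin]≤f[⊤] {f = f} x xs ∷ f[argmin]≤f[xs] {f = f} x xs
  where open ≤-Extrema

exceed : ∀ (lowers : List (Bool × ℚ)) → ∃[ y ] All (λ (_ , l) → l < y) lowers
exceed [] = 0ℚ , []
exceed (b ∷ bs) with greatest proj₂ b bs
... | (_ , m) , _ , ≤m = m + 1ℚ , All.map (λ l≤m → ℚ.≤-<-trans l≤m (p<p+1 m)) ≤m

undercut : ∀ (uppers : List (Bool × ℚ)) → ∃[ y ] All (λ (_ , u) → y < u) uppers
undercut [] = 0ℚ , []
undercut (c ∷ cs) with least proj₂ c cs
... | (_ , n) , _ , n≤ = n - 1ℚ , All.map (ℚ.<-≤-trans (p-1<p n)) n≤

-- With m the largest lower and n the smallest upper value: if m < n take a point in between,
-- otherwise n itself satisfies every bound, by compatibility with the bounds at m and n.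
interpolate : ∀ lowers uppers → Compatible lowers uppers → ∃[ y ] Above lowers y × Below y uppers
interpolate [] uppers _ with undercut uppers
... | y , y< = y , [] , All.map (λ {(t , _)} → <⇒≺ t) y<
interpolate lowers [] _ with exceed lowers
... | y , <y = y , All.map (λ {(s , _)} → <⇒≺ s) <y , []
interpolate (b ∷ bs) (c ∷ cs) compat
  with greatest proj₂ b bs | least proj₂ c cs
... | (s , m) , m∈ , ≤m | (t , n) , n∈ , n≤ with m ℚ.<? n
...   | yes m<n =
  let y , m<y , y<n = ℚ.<-dense m<n in
  y , All.map (λ {(s′ , _)} l≤m → <⇒≺ s′ (ℚ.≤-<-trans l≤m m<y)) ≤m
    , All.map (λ {(t′ , _)} n≤u → <⇒≺ t′ (ℚ.<-≤-trans y<n n≤u)) n≤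
...   | no m≮n =
  n , All.tabulate (λ {(s′ , _)} l∈ → ≺-weakenˡ s′ t (compat l∈ n∈))
    , All.tabulate (λ {(t′ , _)} u∈ → ≤-≺-trans t′ (ℚ.≮⇒≥ m≮n) (≺-weakenʳ s t′ (compat m∈ u∈)))

≈-refl : ∀ {np} {C : Constr np} → C ≈ C
≈-refl w v = (λ c → c) , (λ c → c)

≈-sym : ∀ {np} {C D : Constr np} → C ≈ D → D ≈ C
≈-sym C≈D w v = proj₂ (C≈D w v) , proj₁ (C≈D w v)

≈-trans : ∀ {np} {C D E : Constr np} → C ≈ D → D ≈ E → C ≈ E
≈-trans C≈D D≈E w v =
  (λ c → proj₁ (D≈E w v) (proj₁ (C≈D w v) c)) , (λ e → proj₂ (C≈D w v) (proj₂ (D≈E w v) e))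

≈-setoid : ℕ → Setoid _ _
≈-setoid np = record
  { Carrier = Constr np
  ; _≈_ = _≈_
  ; isEquivalence = record { refl = ≈-refl ; sym = ≈-sym ; trans = ≈-trans }
  }

∧-cong : ∀ {np} {C C′ D D′ : Constr np} → C ≈ C′ → D ≈ D′ → (C ∧ D) ≈ (C′ ∧ D′)
∧-cong C≈C′ D≈D′ w v =
  (λ (c , d) → proj₁ (C≈C′ w v) c , proj₁ (D≈D′ w v) d) ,
  (λ (c , d) → proj₂ (C≈C′ w v) c , proj₂ (D≈D′ w v) d)

↑-cong : ∀ {np} {C D : Constr np} → C ≈ D → (C ↑) ≈ (D ↑)
↑-cong C≈D w v =
  (λ (d , 0≤d , c) → d , 0≤d , proj₁ (C≈D (w - d) v) c) ,
  (λ (d , 0≤d , c) → d , 0≤d , proj₂ (C≈D (w - d) v) c)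

resetC-cong : ∀ {np} b {C D : Constr np} → C ≈ D → resetC b C ≈ resetC b D
resetC-cong false C≈D = C≈D
resetC-cong true C≈D w v =
  (λ (w≡0 , w′ , c) → w≡0 , w′ , proj₁ (C≈D w′ v) c) ,
  (λ (w≡0 , w′ , c) → w≡0 , w′ , proj₂ (C≈D w′ v) c)

p-[p-q]≡q : ∀ p q → p - (p - q) ≡ q
p-[p-q]≡q p q = begin
  p - (p - q)   ≡⟨ cong (p +_) (⁻¹-anti-homo‿- p q) ⟩
  p + (q - p)   ≡⟨ sym (ℚ.+-assoc p q (- p)) ⟩
  p + q - p     ≡⟨ xyx⁻¹≈y p q ⟩
  q             ∎
  where
  open ≡-Reasoning
  open import Algebra.Properties.AbelianGroup ℚ.+-0-abelianGroup using (⁻¹-anti-homo‿-; xyx⁻¹≈y)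

0≤q⇒p-q≤p : ∀ p {q} → 0ℚ ≤ q → p - q ≤ p
0≤q⇒p-q≤p p 0≤q = ℚ.≤-trans (ℚ.+-monoʳ-≤ p (ℚ.neg-antimono-≤ 0≤q)) (ℚ.≤-reflexive (ℚ.+-identityʳ p))

p≤q⇒0≤q-p : ∀ {p q} → p ≤ q → 0ℚ ≤ q - p
p≤q⇒0≤q-p {p} p≤q = ℚ.≤-trans (ℚ.≤-reflexive (sym (ℚ.+-inverseʳ p))) (ℚ.+-monoˡ-≤ (- p) p≤q)

↑-elim : ∀ {np} {C : Constr np} {w v} → (C ↑) w v → ∃[ y ] y ≤ w × C y v
↑-elim {w = w} (d , 0≤d , c) = w - d , 0≤q⇒p-q≤p w 0≤d , c

↑-intro : ∀ {np} {C : Constr np} {w v} → ∃[ y ] y ≤ w × C y v → (C ↑) w v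
↑-intro {C = C} {w} {v} (y , y≤w , c) =
  w - y , p≤q⇒0≤q-p y≤w , subst (λ x → C x v) (sym (p-[p-q]≡q w y)) c

sublists : List A → List (List A)
sublists [] = [ [] ]
sublists (x ∷ xs) = map (x ∷_) (sublists xs) ++ sublists xs

filter-∈-sublists : ∀ {P : Pred A 0ℓ} (P? : Decidable P) xs → filter P? xs ∈ sublists xs
filter-∈-sublists P? [] = here refl
filter-∈-sublists P? (x ∷ xs) with does (P? x)
... | true  = ∈-++⁺ˡ (∈-map⁺ (x ∷_) (filter-∈-sublists P? xs))
... | false = ∈-++⁺ʳ _ (filter-∈-sublists P? xs)

module Canonical (_≟_ : DecidableEquality A) {universe : List A} (complete : ∀ x → x ∈ universe) where
  open import Data.List.Membership.DecPropositional _≟_ using (_∈?_)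

  canonical : List A → List A
  canonical xs = filter (_∈? xs) universe

  canonical-⊆ : ∀ xs → canonical xs ⊆ xs
  canonical-⊆ xs = proj₂ ∘′ ∈-filter⁻ (_∈? xs) {xs = universe}

  ⊆-canonical : ∀ xs → xs ⊆ canonical xs
  ⊆-canonical xs x∈xs = ∈-filter⁺ (_∈? xs) (complete _) x∈xs

  canonical-∈-sublists : ∀ xs → canonical xs ∈ sublists universe
  canonical-∈-sublists xs = filter-∈-sublists (_∈? xs) universe

allBools : List Bool
allBools = true ∷ false ∷ []

∈-allBools : ∀ b → b ∈ allBools
∈-allBools true  = here refl
∈-allBools false = there (here refl)

-- Conjunctions of bounds on the clock and the terms

module Systems {np : ℕ} {Term : Set} (⟦_⟧ : Term → Val np → ℚ) (Dom : Val np → Set) where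

  record System : Set where
    constructor ⟨_,_,_⟩
    field
      lowers : List (Bool × Term)
      uppers : List (Bool × Term)
      free   : List (Bool × Term × Term)

  Holds : Val np → Bool × Term × Term → Set
  Holds v (s , i , j) = ⟦ i ⟧ v ≺[ s ] ⟦ j ⟧ v

  Sat : System → Constr np
  Sat ⟨ ls , us , fs ⟩ w v =
    All (λ (s , i) → ⟦ i ⟧ v ≺[ s ] w) ls × All (λ (t , j) → w ≺[ t ] ⟦ j ⟧ v) us × All (Holds v) fs

  Zone : System → Constr np
  Zone S w v = Dom v × Sat S w v

  bounds : Val np → List (Bool × Term) → List (Bool × ℚ)
  bounds v = map (map₂ (λ i → ⟦ i ⟧ v))

  trivial : System
  trivial = ⟨ [] , [] , [] ⟩

  _⊓_ : System → System → System
  ⟨ ls , us , fs ⟩ ⊓ ⟨ ls′ , us′ , fs′ ⟩ = ⟨ ls ++ ls′ , us ++ us′ , fs ++ fs′ ⟩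

  chains : List (Bool × Term) → List (Bool × Term) → List (Bool × Term × Term)
  chains = cartesianProductWith λ (s , i) (t , j) → s ∨ t , i , j

  elapse : System → System
  elapse ⟨ ls , us , fs ⟩ = ⟨ ls , [] , fs ++ chains ls us ⟩

  reset : Term → System → System
  reset o ⟨ ls , us , fs ⟩ = ⟨ [ false , o ] , [ false , o ] , fs ++ chains ls us ⟩

  relSystem : Rel → Term → System
  relSystem lt i = ⟨ [] , [ true , i ] , [] ⟩
  relSystem le i = ⟨ [] , [ false , i ] , [] ⟩
  relSystem eq i = ⟨ [ false , i ] , [ false , i ] , [] ⟩
  relSystem ge i = ⟨ [ false , i ] , [] , [] ⟩
  relSystem gt i = ⟨ [ true , i ] , [] , [] ⟩

  chains⁺ : ∀ {v} ls us → Compatible (bounds v ls) (bounds v us) → All (Holds v) (chains ls us)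
  chains⁺ ls us compat =
    cartesianProductWith⁺ (setoid _) (setoid _) _ ls us λ i∈ j∈ → compat (∈-map⁺ _ i∈) (∈-map⁺ _ j∈)

  chains⁻ : ∀ {v} ls us → All (Holds v) (chains ls us) → Compatible (bounds v ls) (bounds v us)
  chains⁻ ls us holds l∈ u∈
    with _ , i∈ , refl ← ∈-map⁻ _ l∈
    with _ , j∈ , refl ← ∈-map⁻ _ u∈
    = All.lookup holds (∈-cartesianProductWith⁺ _ i∈ j∈)

  Sat-⊓ : ∀ S S′ → (Sat S ∧ Sat S′) ≈ Sat (S ⊓ S′)
  Sat-⊓ ⟨ ls , us , fs ⟩ ⟨ ls′ , us′ , fs′ ⟩ w v =
    (λ ((l , u , f) , (l′ , u′ , f′)) → ++⁺ l l′ , ++⁺ u u′ , ++⁺ f f′) ,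
    (λ (l , u , f) → let l₁ , l₂ = ++⁻ ls l ; u₁ , u₂ = ++⁻ us u ; f₁ , f₂ = ++⁻ fs f
                     in (l₁ , u₁ , f₁) , (l₂ , u₂ , f₂))

  Zone-⊓ : ∀ S S′ → (Zone S ∧ Sat S′) ≈ Zone (S ⊓ S′)
  Zone-⊓ S S′ w v =
    (λ ((d , s) , s′) → d , proj₁ (Sat-⊓ S S′ w v) (s , s′)) ,
    (λ (d , s⊓s′) → let s , s′ = proj₂ (Sat-⊓ S S′ w v) s⊓s′ in (d , s) , s′)

  relSystem-sound : ∀ r i → (λ w v → relSem r w (⟦ i ⟧ v)) ≈ Sat (relSystem r i)
  relSystem-sound lt i w v = (λ w<i → [] , w<i ∷ [] , []) , (λ { ([] , w<i ∷ [] , []) → w<i })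
  relSystem-sound le i w v = (λ w≤i → [] , w≤i ∷ [] , []) , (λ { ([] , w≤i ∷ [] , []) → w≤i })
  relSystem-sound eq i w v =
    (λ { refl → ℚ.≤-refl ∷ [] , ℚ.≤-refl ∷ [] , [] }) ,
    (λ { (i≤w ∷ [] , w≤i ∷ [] , []) → ℚ.≤-antisym w≤i i≤w })
  relSystem-sound ge i w v = (λ i≤w → i≤w ∷ [] , [] , []) , (λ { (i≤w ∷ [] , [] , []) → i≤w })
  relSystem-sound gt i w v = (λ i<w → i<w ∷ [] , [] , []) , (λ { (i<w ∷ [] , [] , []) → i<w })

  Zone-elapse : ∀ S → (Zone S ↑) ≈ Zone (elapse S)
  Zone-elapse S@(⟨ ls , us , fs ⟩) w v = to ∘′ ↑-elim {C = Zone S} , from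
    where
    to : ∃[ y ] y ≤ w × Zone S y v → Zone (elapse S) w v
    to (y , y≤w , d , l , u , f) =
      d , All.map (λ {(s , _)} i≺y → ≺-≤-trans s i≺y y≤w) l , [] ,
      ++⁺ f (chains⁺ ls us (above-below⇒compatible (map⁺ l) (map⁺ u)))

    from : Zone (elapse S) w v → (Zone S ↑) w v
    from (d , l , [] , f++c) with ++⁻ fs f++c
    ... | f , c with interpolate (bounds v ls) ((false , w) ∷ bounds v us)
                                 (compatible-∷ (map⁺ l) (chains⁻ ls us c))
    ...   | y , l′ , y≤w ∷ u′ = ↑-intro {C = Zone S} (y , y≤w , d , map⁻ l′ , map⁻ u′ , f)

  Zone-reset : ∀ {o} → (∀ v → ⟦ o ⟧ v ≡ 0ℚ) → ∀ S → resetC true (Zone S) ≈ Zone (reset o S)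
  Zone-reset {o} o≡0 S@(⟨ ls , us , fs ⟩) w v = to , from
    where
    to : resetC true (Zone S) w v → Zone (reset o S) w v
    to (refl , y , d , l , u , f) =
      d , ℚ.≤-reflexive (o≡0 v) ∷ [] , ℚ.≤-reflexive (sym (o≡0 v)) ∷ [] ,
      ++⁺ f (chains⁺ ls us (above-below⇒compatible (map⁺ l) (map⁺ u)))

    from : Zone (reset o S) w v → resetC true (Zone S) w v
    from (d , o≤w ∷ [] , w≤o ∷ [] , f++c) with ++⁻ fs f++c
    ... | f , c with interpolate (bounds v ls) (bounds v us) (chains⁻ ls us c)
    ...   | y , l , u = trans (ℚ.≤-antisym w≤o o≤w) (o≡0 v) , y , d , map⁻ l , map⁻ u , f

  record _⊑_ (S S′ : System) : Set where
    field
      lowers-⊆ : System.lowers S ⊆ System.lowers S′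
      uppers-⊆ : System.uppers S ⊆ System.uppers S′
      free-⊆   : System.free S ⊆ System.free S′

  Sat-antitone : ∀ {S S′} → S ⊑ S′ → ∀ {w v} → Sat S′ w v → Sat S w v
  Sat-antitone {⟨ _ , _ , _ ⟩} {⟨ _ , _ , _ ⟩} S⊑S′ (l , u , f) =
    All-resp-⊇ lowers-⊆ l , All-resp-⊇ uppers-⊆ u , All-resp-⊇ free-⊆ f
    where open _⊑_ S⊑S′

  Zone-cong : ∀ {S S′} → S ⊑ S′ → S′ ⊑ S → Zone S ≈ Zone S′
  Zone-cong S⊑S′ S′⊑S w v =
    (λ (d , s) → d , Sat-antitone S′⊑S s) , (λ (d , s′) → d , Sat-antitone S⊑S′ s′)

  module Finiteness (_≟_ : DecidableEquality Term) {terms : List Term} (complete : ∀ i → i ∈ terms) where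
    private
      module Bounds = Canonical (≡-dec Bool._≟_ _≟_) {cartesianProduct allBools terms}
        (λ (s , i) → ∈-cartesianProduct⁺ (∈-allBools s) (complete i))
      module Free = Canonical (≡-dec Bool._≟_ (≡-dec _≟_ _≟_)) {cartesianProduct allBools (cartesianProduct terms terms)}
        (λ (s , i , j) → ∈-cartesianProduct⁺ (∈-allBools s) (∈-cartesianProduct⁺ (complete i) (complete j)))

    allSystems : List System
    allSystems =
      cartesianProductWith (λ ls (us , fs) → ⟨ ls , us , fs ⟩)
        (sublists (cartesianProduct allBools terms))
        (cartesianProduct (sublists (cartesianProduct allBools terms))
                          (sublists (cartesianProduct allBools (cartesianProduct terms terms))))

    finitely-many-zones : ∀ S → ∃[ S′ ] S′ ∈ allSystems × Zone S ≈ Zone S′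
    finitely-many-zones ⟨ ls , us , fs ⟩ =
      ⟨ Bounds.canonical ls , Bounds.canonical us , Free.canonical fs ⟩ ,
      ∈-cartesianProductWith⁺ _ (Bounds.canonical-∈-sublists ls)
        (∈-cartesianProduct⁺ (Bounds.canonical-∈-sublists us) (Free.canonical-∈-sublists fs)) ,
      Zone-cong
        (record { lowers-⊆ = Bounds.⊆-canonical ls ; uppers-⊆ = Bounds.⊆-canonical us ; free-⊆ = Free.⊆-canonical fs })
        (record { lowers-⊆ = Bounds.canonical-⊆ ls ; uppers-⊆ = Bounds.canonical-⊆ us ; free-⊆ = Free.canonical-⊆ fs })

atomValue : ∀ {np} → Atom np → Val np → ℚ
atomValue {np} (atom _ α c) v = sumFin np (λ i → ℤ→ℚ (α i) * v i) + ℤ→ℚ c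

module ZoneGraph (A : PTA) where
  open PTA A

  atoms : List (Atom np)
  atoms = concatMap inv (allFin nL) ++ concatMap Edge.guard edges

  Term : Set
  Term = Fin (suc (length atoms))

  ⟦_⟧ : Term → Val np → ℚ
  ⟦ zero  ⟧ v = 0ℚ
  ⟦ suc k ⟧ v = atomValue (lookup atoms k) v

  NonNegative : Val np → Set
  NonNegative v = ∀ i → 0ℚ ≤ v i

  open Systems ⟦_⟧ NonNegative public
  open Finiteness Fin._≟_ ∈-allFin public
  open import Relation.Binary.Reasoning.Setoid (≈-setoid np)

  term : ∀ {a} → a ∈ atoms → Term
  term a∈ = suc (Any.index a∈)

  ⟦term⟧ : ∀ {a} (a∈ : a ∈ atoms) v → ⟦ term a∈ ⟧ v ≡ atomValue a v
  ⟦term⟧ a∈ v = cong (λ a → atomValue a v) (sym (lookup-index a∈))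

  inv⊆atoms : ∀ ℓ → inv ℓ ⊆ atoms
  inv⊆atoms ℓ a∈ = ∈-++⁺ˡ (∈-concatMap⁺ inv (lose (∈-allFin ℓ) a∈))

  guard⊆atoms : ∀ {e} → e ∈ edges → Edge.guard e ⊆ atoms
  guard⊆atoms e∈ a∈ = ∈-++⁺ʳ _ (∈-concatMap⁺ Edge.guard (lose e∈ a∈))

  guardSystem : (g : Guard np) → g ⊆ atoms → System
  guardSystem [] _ = trivial
  guardSystem (a ∷ g) g⊆ = relSystem (Atom.rel a) (term (g⊆ (here refl))) ⊓ guardSystem g (g⊆ ∘′ there)

  atom-sound : ∀ {a} (a∈ : a ∈ atoms) → atomSem a ≈ Sat (relSystem (Atom.rel a) (term a∈))
  atom-sound {a} a∈ = ≈-trans at-term (relSystem-sound (Atom.rel a) (term a∈))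
    where
    at-term : atomSem a ≈ (λ w v → relSem (Atom.rel a) w (⟦ term a∈ ⟧ v))
    at-term w v =
      subst (relSem (Atom.rel a) w) (sym (⟦term⟧ a∈ v)) , subst (relSem (Atom.rel a) w) (⟦term⟧ a∈ v)

  guardSystem-sound : ∀ g (g⊆ : g ⊆ atoms) → guardSem g ≈ Sat (guardSystem g g⊆)
  guardSystem-sound [] _ w v = (λ _ → [] , [] , []) , (λ _ → [])
  guardSystem-sound (a ∷ g) g⊆ = begin
    guardSem (a ∷ g)
      ≈⟨ (λ w v → (λ { (h ∷ hs) → h , hs }) , (λ (h , hs) → h ∷ hs)) ⟩
    atomSem a ∧ guardSem g
      ≈⟨ ∧-cong (atom-sound (g⊆ (here refl))) (guardSystem-sound g (g⊆ ∘′ there)) ⟩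
    Sat (relSystem (Atom.rel a) (term (g⊆ (here refl)))) ∧ Sat (guardSystem g (g⊆ ∘′ there))
      ≈⟨ Sat-⊓ _ _ ⟩
    Sat (guardSystem (a ∷ g) g⊆) ∎

  resetIf : Bool → System → System
  resetIf false S = S
  resetIf true  S = reset zero S

  Zone-resetIf : ∀ b S → resetC b (Zone S) ≈ Zone (resetIf b S)
  Zone-resetIf false S = ≈-refl
  Zone-resetIf true  S = Zone-reset (λ _ → refl) S

  initSystem : System
  initSystem = ⟨ [ false , zero ] , [] , [] ⟩ ⊓ guardSystem (inv ℓ₀) (inv⊆atoms ℓ₀)

  initC-sound : initC A ≈ Zone initSystem
  initC-sound = begin
    (NonNegVal A ∧ (xIsZero A ↑)) ∧ guardSem (inv ℓ₀)
      ≈⟨ ∧-cong elapsed-zero (guardSystem-sound (inv ℓ₀) (inv⊆atoms ℓ₀)) ⟩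
    Zone ⟨ [ false , zero ] , [] , [] ⟩ ∧ Sat (guardSystem (inv ℓ₀) (inv⊆atoms ℓ₀))
      ≈⟨ Zone-⊓ _ _ ⟩
    Zone initSystem ∎
    where
    elapsed-zero : (NonNegVal A ∧ (xIsZero A ↑)) ≈ Zone ⟨ [ false , zero ] , [] , [] ⟩
    elapsed-zero w v =
      (λ (d , x↑) → d , zero≤ (↑-elim {C = xIsZero A} {w} {v} x↑) ∷ [] , [] , []) ,
      (λ { (d , 0≤w ∷ [] , [] , []) → d , ↑-intro {C = xIsZero A} {w} {v} (0ℚ , 0≤w , refl) })
      where
      zero≤ : ∃[ y ] y ≤ w × y ≡ 0ℚ → 0ℚ ≤ w
      zero≤ (_ , y≤w , refl) = y≤w

  post : (e : Edge nL nΣ np) → e ∈ edges → System → System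
  post e e∈ S =
    elapse (resetIf (Edge.reset e) (S ⊓ guardSystem (Edge.guard e) (guard⊆atoms e∈)))
      ⊓ guardSystem (inv (Edge.tgt e)) (inv⊆atoms (Edge.tgt e))

  postC-sound : ∀ {e} (e∈ : e ∈ edges) {C S} → C ≈ Zone S → postC A e C ≈ Zone (post e e∈ S)
  postC-sound {e} e∈ {C} {S} C≈S = begin
    (resetC r (C ∧ guardSem g) ↑) ∧ guardSem i
      ≈⟨ ∧-cong (↑-cong (resetC-cong r (∧-cong C≈S (guardSystem-sound g g⊆)))) (guardSystem-sound i i⊆) ⟩
    (resetC r (Zone S ∧ Sat G) ↑) ∧ Sat I
      ≈⟨ ∧-cong (↑-cong (resetC-cong r (Zone-⊓ S G))) ≈-refl ⟩
    (resetC r (Zone (S ⊓ G)) ↑) ∧ Sat I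
      ≈⟨ ∧-cong (↑-cong (Zone-resetIf r (S ⊓ G))) ≈-refl ⟩
    (Zone (resetIf r (S ⊓ G)) ↑) ∧ Sat I
      ≈⟨ ∧-cong (Zone-elapse _) ≈-refl ⟩
    Zone (elapse (resetIf r (S ⊓ G))) ∧ Sat I
      ≈⟨ Zone-⊓ _ I ⟩
    Zone (post e e∈ S) ∎
    where
    r = Edge.reset e
    g = Edge.guard e
    g⊆ = guard⊆atoms e∈
    G = guardSystem g g⊆
    i = inv (Edge.tgt e)
    i⊆ = inv⊆atoms (Edge.tgt e)
    I = guardSystem i i⊆

  represent : ∀ {ℓ C} → Reachable A ℓ C → ∃[ S ] C ≈ Zone S
  represent init = initSystem , initC-sound
  represent (step e r e∈ _ _) =
    let S , C≈S = represent r
    in post e (Any.map sym e∈) S , postC-sound (Any.map sym e∈) C≈S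

theorem5p4 : (A : PTA) → FiniteZoneGraph A
theorem5p4 A = states , covered
  where
  open PTA A
  open ZoneGraph A

  states : List (Σ (Fin nL) (λ _ → Constr np))
  states = cartesianProductWith (λ ℓ S → ℓ , Zone S) (allFin nL) allSystems

  covered : ∀ ℓ C → Reachable A ℓ C → Any (λ S → Σ (ℓ ≡ proj₁ S) (λ _ → C ≈ proj₂ S)) states
  covered ℓ C reachable =
    let S , C≈S = represent reachable
        S′ , S′∈ , S≈S′ = finitely-many-zones S
    in Any.map (λ { refl → refl , ≈-trans C≈S S≈S′ }) (∈-cartesianProductWith⁺ _ (∈-allFin ℓ) S′∈)
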